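{- Let $\Sigma=\{s_0,s_1,\dots,s_{\sigma-1}\}$ be an ordered alphabet of size $\sigma\ge 1$ with $s_0<s_1<\dots<s_{\sigma-1}$, and let \[K = s_{\sigma-1}^{k_{\sigma-1}}\, s_{\sigma-2}^{k_{\sigma-2}} \cdots s_1^{k_1}\, s_0^{k_0}\] with integers $k_i>1$ for all $i$. Then $\operatorname{BWT}(K\$)$ has exactly $r=\sigma+1$ runs.
   Context: Here $\$\notin\Sigma$ is an end-marker smaller than every letter of $\Sigma$, and $K\$$ denotes $K$ followed by one $\$$. For a string $w\$$ of length $n$, $\operatorname{BWT}(w\$)$ is the last column of the $n\times n$ matrix whose rows are all cyclic rotations of $w\$$ sorted lexicographically; equivalently $\operatorname{BWT}(w\$)[i]=w\$[(\operatorname{SA}[i]-1)\bmod n]$, where $\operatorname{SA}$ is the suffix array of $w\$$. A run is a maximal substring consisting of equal letters; $r$ is the number of runs of $\operatorname{BWT}(w\$)$. -}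

module Defs where

open import Data.Nat using (ℕ; zero; suc; _≤ᵇ_; _<ᵇ_; _≡ᵇ_)
open import Data.Bool using (Bool; true; false; if_then_else_)
open import Data.Fin using (Fin; fromℕ<)
open import Data.List using (List; []; _∷_; _++_; replicate; length; drop; take; map; upTo; last; concat)
open import Data.Maybe using (Maybe; just; nothing)
open import Data.Nat.Properties using (n<1+n)

-- Encoding of symbols as natural numbers:
--   the end-marker $ is 0, and the letter s_i of Σ is (suc i).
-- Thus $ < s_0 < s_1 < ... < s_{σ-1}, as in the paper.
endMarker : ℕ
endMarker = 0

letter : ℕ → ℕ
letter i = suc i

Kword : (σ : ℕ) → (Fin σ → ℕ) → List ℕ
Kword zero    k = []
Kword (suc n) k = replicate (k (fromℕ< (n<1+n n))) (letter n)
                  ++ Kword n (λ i → k (Data.Fin.inject₁ i))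

lexLt : List ℕ → List ℕ → Bool
lexLt []       []       = false
lexLt []       (_ ∷ _)  = true
lexLt (_ ∷ _)  []       = false
lexLt (x ∷ xs) (y ∷ ys) =
  if x <ᵇ y then true else (if y <ᵇ x then false else lexLt xs ys)

insert : List ℕ → List (List ℕ) → List (List ℕ)
insert u []       = u ∷ []
insert u (v ∷ vs) = if lexLt v u then v ∷ insert u vs else u ∷ v ∷ vs

sortLex : List (List ℕ) → List (List ℕ)
sortLex []       = []
sortLex (u ∷ us) = insert u (sortLex us)

rotation : List ℕ → ℕ → List ℕ
rotation w i = drop i w ++ take i w

rotations : List ℕ → List (List ℕ)
rotations w = map (rotation w) (upTo (length w))

-- last letter of a row (rows are nonempty when w is nonempty)
lastLetter : List ℕ → List ℕ
lastLetter u with last u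
... | just x  = x ∷ []
... | nothing = []

BWT : List ℕ → List ℕ
BWT w = concat (map lastLetter (sortLex (rotations w)))

runsFrom : ℕ → List ℕ → ℕ
runsFrom x []       = 0
runsFrom x (y ∷ ys) = if x ≡ᵇ y then runsFrom y ys else suc (runsFrom y ys)

runs : List ℕ → ℕ
runs []       = 0
runs (x ∷ xs) = suc (runsFrom x xs)

-- K$ is non-increasing and ends with its unique smallest letter $. Comparing two of its
-- rotations, the one that starts later reads, letter by letter, at most what the other
-- reads, and reaches $ first while the other still reads a letter of K; so the later
-- rotation is lexicographically smaller. The sorted matrix therefore lists the rotations
-- in reverse order, and its last column is the reverse of $K, namely
-- s_0^{k_0} s_1^{k_1} ... s_{σ-1}^{k_{σ-1}} $, which has σ + 1 runs.
module Submission where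

open import Defs
open import Data.Bool using (true; false)
open import Data.Bool.Properties using (T-≡; ¬-not)
open import Data.Fin using (Fin; inject₁)
open import Data.List using (List; []; _∷_; _++_; _∷ʳ_; [_]; replicate; length; drop; take; map; upTo; applyUpTo; last; concat; reverse)
open import Data.List.Properties using (++-assoc; ++-identityʳ; length-++; map-cong; map-∘; map-upTo; reverse-map; unfold-reverse; concat-map-[_])
open import Data.List.Relation.Binary.Permutation.Propositional using (↭-sym)
open import Data.List.Relation.Binary.Permutation.Propositional.Properties using (All-resp-↭; ↭-reverse)
open import Data.List.Relation.Binary.Pointwise as Pointwise using ()
open import Data.List.Relation.Binary.Prefix.Heterogeneous using (Prefix; []; _∷_)
open import Data.List.Relation.Binary.Prefix.Heterogeneous.Properties as Prefix using (length-mono; fromPointwise)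
open import Data.List.Relation.Unary.All as All using (All; []; _∷_)
open import Data.List.Relation.Unary.All.Properties as All using ()
open import Data.List.Relation.Unary.AllPairs using (AllPairs; []; _∷_)
open import Data.List.Relation.Unary.AllPairs.Properties as AllPairs using ()
open import Data.List.Relation.Unary.Linked as Linked using (Linked; []; [-]; _∷_; _∷′_)
open import Data.Maybe using (just; nothing; maybe′)
open import Data.Maybe.Relation.Binary.Connected using (just)
open import Data.Nat using (ℕ; zero; suc; _+_; _≤_; _<_; _≥_; _<ᵇ_; _≡ᵇ_; s≤s; z<s; s≤s⁻¹)
open import Data.Nat.Properties using (≤-refl; ≤-trans; <⇒≤; <-trans; m≤n⇒m≤1+n; m≤n⇒m<n∨m≡n; <⇒<ᵇ; ≡ᵇ⇒≡; ≡⇒≡ᵇ; <⇒≢; 1+n≢n; +-comm)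
open import Data.Sum using (inj₁; inj₂)
open import Function using (_∘_; Equivalence)
open import Relation.Binary.PropositionalEquality using (_≡_; _≗_; _≢_; refl; sym; trans; cong; cong₂; subst; subst₂; module ≡-Reasoning)

open Equivalence using (to; from)

<ᵇ-irrefl : ∀ n → (n <ᵇ n) ≡ false
<ᵇ-irrefl zero    = refl
<ᵇ-irrefl (suc n) = <ᵇ-irrefl n

≡ᵇ-refl : ∀ n → (n ≡ᵇ n) ≡ true
≡ᵇ-refl n = to T-≡ (≡⇒≡ᵇ n n refl)

≢⇒≡ᵇ≡false : ∀ {m n} → m ≢ n → (m ≡ᵇ n) ≡ false
≢⇒≡ᵇ≡false {m} {n} m≢n = ¬-not (m≢n ∘ ≡ᵇ⇒≡ m n ∘ from T-≡)

≡ᵇ-sym : ∀ m n → (m ≡ᵇ n) ≡ (n ≡ᵇ m)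
≡ᵇ-sym zero    zero    = refl
≡ᵇ-sym zero    (suc n) = refl
≡ᵇ-sym (suc m) zero    = refl
≡ᵇ-sym (suc m) (suc n) = ≡ᵇ-sym m n

infix 4 _<lex_ _>lex_

_<lex_ : List ℕ → List ℕ → Set
u <lex v = lexLt u v ≡ true

_>lex_ : List ℕ → List ℕ → Set
u >lex v = v <lex u

<lex-head : ∀ {x y} xs ys → x < y → (x ∷ xs) <lex (y ∷ ys)
<lex-head {x} {y} _ _ x<y rewrite to T-≡ (<⇒<ᵇ {x} {y} x<y) = refl

<lex-cons : ∀ x {xs ys} → xs <lex ys → (x ∷ xs) <lex (x ∷ ys)
<lex-cons x xs<ys rewrite <ᵇ-irrefl x = xs<ys

-- bs reaches the separator m while as still holds a letter greater than m.
<lex-Prefix : ∀ {m bs as} → Prefix _≤_ bs as → length bs < length as → All (m <_) as →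
              ∀ c e → (bs ++ m ∷ c) <lex (as ++ m ∷ e)
<lex-Prefix {as = a ∷ as} [] _ (m<a ∷ _) c e = <lex-head c (as ++ _ ∷ e) m<a
<lex-Prefix {bs = b ∷ bs} {a ∷ as} (b≤a ∷ bs≤as) (s≤s |bs|<|as|) (_ ∷ m<as) c e
  with m≤n⇒m<n∨m≡n b≤a
... | inj₁ b<a  = <lex-head (bs ++ _ ∷ c) (as ++ _ ∷ e) b<a
... | inj₂ refl = <lex-cons b {bs ++ _ ∷ c} {as ++ _ ∷ e} (<lex-Prefix bs≤as |bs|<|as| m<as c e)

Prefix-tail : ∀ {x xs} → Linked _≥_ (x ∷ xs) → Prefix _≤_ xs (x ∷ xs)
Prefix-tail [-]            = []
Prefix-tail (x≥y ∷ y∷xs↘) = x≥y ∷ Prefix-tail y∷xs↘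

Prefix-drop : ∀ {xs} → Linked _≥_ xs → ∀ d → Prefix _≤_ (drop d xs) xs
Prefix-drop _            zero    = fromPointwise (Pointwise.refl ≤-refl)
Prefix-drop {[]}    _    (suc d) = []
Prefix-drop {_ ∷ _} xs↘ (suc d) =
  Prefix.trans ≤-trans (Prefix-drop (Linked.tail xs↘) d) (Prefix-tail xs↘)

<lex-drop : ∀ {m xs i j} → Linked _≥_ xs → All (m <_) xs → i < j → j ≤ length xs →
            ∀ c e → (drop j xs ++ m ∷ c) <lex (drop i xs ++ m ∷ e)
<lex-drop {xs = _ ∷ _} {zero} {suc j} xs↘ m<xs _ _ =
  <lex-Prefix (Prefix-drop xs↘ (suc j)) (s≤s (length-mono (Prefix-drop (Linked.tail xs↘) j))) m<xs
<lex-drop {xs = _ ∷ _} {suc i} {suc j} xs↘ (_ ∷ m<xs) (s≤s i<j) (s≤s j≤|xs|) =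
  <lex-drop (Linked.tail xs↘) m<xs i<j j≤|xs|

length-∷ʳ : ∀ (xs : List ℕ) x → length (xs ∷ʳ x) ≡ suc (length xs)
length-∷ʳ xs x = trans (length-++ xs) (+-comm (length xs) 1)

drop-++ : ∀ {i} (xs ys : List ℕ) → i ≤ length xs → drop i (xs ++ ys) ≡ drop i xs ++ ys
drop-++ {zero}  _        _  _           = refl
drop-++ {suc i} (_ ∷ xs) ys (s≤s i≤|xs|) = drop-++ xs ys i≤|xs|

rotation-∷ʳ : ∀ {i} m xs → i ≤ length xs →
              rotation (xs ∷ʳ m) i ≡ drop i xs ++ m ∷ take i (xs ∷ʳ m)
rotation-∷ʳ {i} m xs i≤|xs| =
  trans (cong (_++ take i (xs ∷ʳ m)) (drop-++ xs [ m ] i≤|xs|))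
        (++-assoc (drop i xs) [ m ] (take i (xs ∷ʳ m)))

rotations-descending : ∀ {m xs} → Linked _≥_ xs → All (m <_) xs →
                       AllPairs _>lex_ (rotations (xs ∷ʳ m))
rotations-descending {m} {xs} xs↘ m<xs =
  subst (AllPairs _>lex_) (sym (map-upTo (rotation w) (length w)))
        (AllPairs.applyUpTo⁺₁ (rotation w) (length w) later<earlier)
  where
  w : List ℕ
  w = xs ∷ʳ m
  later<earlier : ∀ {i j} → i < j → j < length w → rotation w j <lex rotation w i
  later<earlier {i} {j} i<j j<|w| =
    subst₂ _<lex_ (sym (rotation-∷ʳ m xs j≤|xs|)) (sym (rotation-∷ʳ m xs (≤-trans (<⇒≤ i<j) j≤|xs|)))
           (<lex-drop xs↘ m<xs i<j j≤|xs| (take j w) (take i w))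
    where
    j≤|xs| : j ≤ length xs
    j≤|xs| = s≤s⁻¹ (subst (j <_) (length-∷ʳ xs m) j<|w|)

insert-∷ʳ : ∀ {u vs} → All (_<lex u) vs → insert u vs ≡ vs ∷ʳ u
insert-∷ʳ []                       = refl
insert-∷ʳ {vs = v ∷ _} (v<u ∷ vs<u) rewrite v<u = cong (v ∷_) (insert-∷ʳ vs<u)

sortLex-descending : ∀ {us} → AllPairs _>lex_ us → sortLex us ≡ reverse us
sortLex-descending {[]}     []            = refl
sortLex-descending {u ∷ us} (us<u ∷ us↘)
  rewrite sortLex-descending us↘ | unfold-reverse u us =
  insert-∷ʳ (All-resp-↭ (↭-sym (↭-reverse us)) us<u)

last-++-∷ : ∀ (xs : List ℕ) y ys → last (xs ++ y ∷ ys) ≡ last (y ∷ ys)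
last-++-∷ []           _ _  = refl
last-++-∷ (_ ∷ [])     _ _  = refl
last-++-∷ (_ ∷ x ∷ xs) y ys = last-++-∷ (x ∷ xs) y ys

last-rotation-suc : ∀ w i → last (rotation w (suc i)) ≡ last (take (suc i) w)
last-rotation-suc []      _ = refl
last-rotation-suc (x ∷ w) i = last-++-∷ (drop i w) x (take i w)

applyUpTo-last-take : ∀ (xs ys : List ℕ) →
                      applyUpTo (λ i → last (take (suc i) (xs ++ ys))) (length xs) ≡ map just xs
applyUpTo-last-take []           _  = refl
applyUpTo-last-take (_ ∷ [])     _  = refl
applyUpTo-last-take (x ∷ y ∷ xs) ys = cong (just x ∷_) (applyUpTo-last-take (y ∷ xs) ys)

map-last-rotations : ∀ m xs → map last (rotations (xs ∷ʳ m)) ≡ map just (m ∷ xs)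
map-last-rotations m xs = begin
  map last (map (rotation w) (upTo (length w)))  ≡⟨ map-∘ (upTo (length w)) ⟨
  map (last ∘ rotation w) (upTo (length w))      ≡⟨ map-upTo (last ∘ rotation w) (length w) ⟩
  applyUpTo (last ∘ rotation w) (length w)       ≡⟨ cong (applyUpTo (last ∘ rotation w)) (length-∷ʳ xs m) ⟩
  last (w ++ []) ∷ applyUpTo (λ i → last (rotation w (suc i))) (length xs)
    ≡⟨ cong₂ _∷_ (trans (cong last (++-identityʳ w)) (last-++-∷ xs m [])) tail-column ⟩
  just m ∷ map just xs                           ∎
  where
  open ≡-Reasoning
  w : List ℕ
  w = xs ∷ʳ m
  tail-column : applyUpTo (λ i → last (rotation w (suc i))) (length xs) ≡ map just xs
  tail-column = begin
    applyUpTo (λ i → last (rotation w (suc i))) (length xs)  ≡⟨ map-upTo _ (length xs) ⟨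
    map (λ i → last (rotation w (suc i))) (upTo (length xs)) ≡⟨ map-cong (last-rotation-suc w) (upTo (length xs)) ⟩
    map (λ i → last (take (suc i) w)) (upTo (length xs))     ≡⟨ map-upTo _ (length xs) ⟩
    applyUpTo (λ i → last (take (suc i) w)) (length xs)      ≡⟨ applyUpTo-last-take xs [ m ] ⟩
    map just xs                                               ∎

lastLetter-last : lastLetter ≗ maybe′ [_] [] ∘ last
lastLetter-last u with last u
... | just _  = refl
... | nothing = refl

map-lastLetter-rotations : ∀ m xs → map lastLetter (rotations (xs ∷ʳ m)) ≡ map [_] (m ∷ xs)
map-lastLetter-rotations m xs = begin
  map lastLetter (rotations (xs ∷ʳ m))                      ≡⟨ map-cong lastLetter-last _ ⟩
  map (maybe′ [_] [] ∘ last) (rotations (xs ∷ʳ m))          ≡⟨ map-∘ _ ⟩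
  map (maybe′ [_] []) (map last (rotations (xs ∷ʳ m)))      ≡⟨ cong (map (maybe′ [_] [])) (map-last-rotations m xs) ⟩
  map (maybe′ [_] []) (map just (m ∷ xs))                   ≡⟨ map-∘ (m ∷ xs) ⟨
  map [_] (m ∷ xs)                                          ∎
  where open ≡-Reasoning

BWT-nonincreasing : ∀ {m xs} → Linked _≥_ xs → All (m <_) xs → BWT (xs ∷ʳ m) ≡ reverse (m ∷ xs)
BWT-nonincreasing {m} {xs} xs↘ m<xs = begin
  concat (map lastLetter (sortLex (rotations w)))  ≡⟨ cong (concat ∘ map lastLetter) (sortLex-descending (rotations-descending xs↘ m<xs)) ⟩
  concat (map lastLetter (reverse (rotations w)))  ≡⟨ cong concat (reverse-map lastLetter (rotations w)) ⟩
  concat (reverse (map lastLetter (rotations w)))  ≡⟨ cong (concat ∘ reverse) (map-lastLetter-rotations m xs) ⟩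
  concat (reverse (map [_] (m ∷ xs)))              ≡⟨ cong concat (reverse-map [_] (m ∷ xs)) ⟨
  concat (map [_] (reverse (m ∷ xs)))              ≡⟨ concat-map-[ reverse (m ∷ xs) ] ⟩
  reverse (m ∷ xs)                                 ∎
  where
  open ≡-Reasoning
  w : List ℕ
  w = xs ∷ʳ m

runsFrom-++-∷ : ∀ x xs y ys → runsFrom x (xs ++ y ∷ ys) ≡ runsFrom x (xs ∷ʳ y) + runsFrom y ys
runsFrom-++-∷ x [] y ys with x ≡ᵇ y
... | true  = refl
... | false = refl
runsFrom-++-∷ x (z ∷ xs) y ys with x ≡ᵇ z
... | true  = runsFrom-++-∷ z xs y ys
... | false = cong suc (runsFrom-++-∷ z xs y ys)

runs-++-∷ : ∀ xs y ys → runs (xs ++ y ∷ ys) ≡ runs (xs ∷ʳ y) + runsFrom y ys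
runs-++-∷ []       y ys = refl
runs-++-∷ (x ∷ xs) y ys = cong suc (runsFrom-++-∷ x xs y ys)

runsFrom-[]-sym : ∀ x y → runsFrom x [ y ] ≡ runsFrom y [ x ]
runsFrom-[]-sym x y rewrite ≡ᵇ-sym x y = refl

runs-reverse-∷ : ∀ x xs → runs (reverse xs ∷ʳ x) ≡ suc (runsFrom x xs)
runs-reverse-∷ x []       = refl
runs-reverse-∷ x (y ∷ ys) = begin
  runs (reverse (y ∷ ys) ∷ʳ x)                 ≡⟨ cong (λ zs → runs (zs ∷ʳ x)) (unfold-reverse y ys) ⟩
  runs ((reverse ys ∷ʳ y) ∷ʳ x)                ≡⟨ cong runs (++-assoc (reverse ys) [ y ] [ x ]) ⟩
  runs (reverse ys ++ y ∷ [ x ])               ≡⟨ runs-++-∷ (reverse ys) y [ x ] ⟩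
  runs (reverse ys ∷ʳ y) + runsFrom y [ x ]    ≡⟨ cong₂ _+_ (runs-reverse-∷ y ys) (runsFrom-[]-sym y x) ⟩
  suc (runsFrom y ys + runsFrom x [ y ])       ≡⟨ cong suc (+-comm (runsFrom y ys) _) ⟩
  suc (runsFrom x [ y ] + runsFrom y ys)       ≡⟨ cong suc (runsFrom-++-∷ x [] y ys) ⟨
  suc (runsFrom x (y ∷ ys))                    ∎
  where open ≡-Reasoning

runs-reverse : ∀ xs → runs (reverse xs) ≡ runs xs
runs-reverse []       = refl
runs-reverse (x ∷ xs) = trans (cong runs (unfold-reverse x xs)) (runs-reverse-∷ x xs)

runsFrom-replicate-++ : ∀ y c ys → runsFrom y (replicate c y ++ ys) ≡ runsFrom y ys
runsFrom-replicate-++ y zero    ys = refl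
runsFrom-replicate-++ y (suc c) ys rewrite ≡ᵇ-refl y = runsFrom-replicate-++ y c ys

runsFrom-replicate-++-≢ : ∀ {x y c} ys → x ≢ y → 0 < c →
                          runsFrom x (replicate c y ++ ys) ≡ suc (runsFrom y ys)
runsFrom-replicate-++-≢ {y = y} {suc c} ys x≢y _ rewrite ≢⇒≡ᵇ≡false x≢y =
  cong suc (runsFrom-replicate-++ y c ys)

Kword-≤ : ∀ n k → All (_≤ n) (Kword n k)
Kword-≤ zero    k = []
Kword-≤ (suc n) k = All.++⁺ (All.replicate⁺ _ ≤-refl) (All.map m≤n⇒m≤1+n (Kword-≤ n (k ∘ inject₁)))

Kword-positive : ∀ n k → All (0 <_) (Kword n k)
Kword-positive zero    k = []
Kword-positive (suc n) k = All.++⁺ (All.replicate⁺ _ z<s) (Kword-positive n (k ∘ inject₁))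

Linked-replicate-++ : ∀ {x ys} c → All (_≤ x) ys → Linked _≥_ ys → Linked _≥_ (replicate c x ++ ys)
Linked-replicate-++ zero          _         ys↘ = ys↘
Linked-replicate-++ (suc zero)    []        ys↘ = [-]
Linked-replicate-++ (suc zero)    (y≤x ∷ _) ys↘ = just y≤x ∷′ ys↘
Linked-replicate-++ (suc (suc c)) ys≤x      ys↘ = ≤-refl ∷ Linked-replicate-++ (suc c) ys≤x ys↘

Kword-nonincreasing : ∀ n k → Linked _≥_ (Kword n k)
Kword-nonincreasing zero    k = []
Kword-nonincreasing (suc n) k =
  Linked-replicate-++ {x = suc n} _ (All.map m≤n⇒m≤1+n (Kword-≤ n (k ∘ inject₁))) (Kword-nonincreasing n (k ∘ inject₁))

runsFrom-Kword : ∀ n k → (∀ i → 0 < k i) → ∀ {x} → x ≢ n → runsFrom x (Kword n k) ≡ n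
runsFrom-Kword zero    k _   _   = refl
runsFrom-Kword (suc n) k k>0 x≢n =
  trans (runsFrom-replicate-++-≢ (Kword n (k ∘ inject₁)) x≢n (k>0 _))
        (cong suc (runsFrom-Kword n (k ∘ inject₁) (k>0 ∘ inject₁) 1+n≢n))

lemma1 : (σ : ℕ) → 1 ≤ σ → (k : Fin σ → ℕ) → (∀ i → 1 < k i) →
    runs (BWT (Kword σ k ++ (endMarker ∷ []))) ≡ suc σ
lemma1 σ σ≥1 k k>1 = begin
  runs (BWT (K ∷ʳ endMarker))     ≡⟨ cong runs (BWT-nonincreasing (Kword-nonincreasing σ k) (Kword-positive σ k)) ⟩
  runs (reverse (endMarker ∷ K))  ≡⟨ runs-reverse (endMarker ∷ K) ⟩
  suc (runsFrom endMarker K)      ≡⟨ cong suc (runsFrom-Kword σ k (λ i → <-trans z<s (k>1 i)) (<⇒≢ σ≥1)) ⟩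
  suc σ                           ∎
  where
  open ≡-Reasoning
  K : List ℕ
  K = Kword σ k
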